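{- Let $G$ be a bicritical graph with a 2-separation $\{u,v\}$. Suppose $G=G_1'\cup G_2'$ where $V(G_1')\cap V(G_2')=\{u,v\}$ and $G_1',G_2'$ are connected graphs different from $K_2$; for $i=1,2$ let $G_i=G_i'+uv$ if $uv\notin E(G_i')$ and $G_i=G_i'$ otherwise. Then: (1) if $uv\notin E(G)$, then $DE(G_i)\setminus\{uv\}=DE(G)\cap E(G_i)$ for $i=1,2$; (2) if $uv\in E(G)$, then $DE(G_i)\cup\{uv\}=DE(G)\cap E(G_i)$ for $i=1,2$.
   Context: All graphs are finite and simple. A graph with at least four vertices is bicritical if deleting any two distinct vertices leaves a graph with a perfect matching. A barrier of a graph $G$ with a perfect matching is a set $B\subseteq V(G)$ with $c_o(G-B)=|B|$, where $c_o$ denotes the number of odd components; a 2-separation is a 2-vertex cut that is not a barrier. For a bicritical graph $H$, an edge $e$ is deletable if $H-e$ is bicritical, and $DE(H)$ denotes the set of all deletable edges of $H$. $G+uv$ denotes the graph obtained by adding the edge $uv$. -}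

module Defs where

open import Data.Nat using (ℕ; zero; suc; _+_; _≤_)
open import Data.Bool using (Bool; true; false; _∧_; _∨_; not; if_then_else_)
open import Data.Fin using (Fin; _<?_)
open import Data.Fin.Properties using (_≟_)
open import Data.List using (List; map; allFin)
open import Data.Nat.ListAction using (sum)
open import Data.Bool.ListAction using (any)
open import Data.Product using (Σ; _×_; _,_; ∃)
open import Data.Sum using (_⊎_)
open import Relation.Nullary using (¬_)
open import Relation.Nullary.Decidable using (⌊_⌋)
open import Relation.Binary.PropositionalEquality using (_≡_; _≢_)
open import Function.Bundles using (_⇔_)

-- A (raw) finite graph whose vertices form a subset of the universe Fin n.
-- V x : x is a vertex; E x y : xy is an edge.
record Graph (n : ℕ) : Set where
  constructor mkGraph
  field
    V : Fin n → Bool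
    E : Fin n → Fin n → Bool
open Graph public

IsGraph : ∀ {n} → Graph n → Set
IsGraph G = (∀ x y → E G x y ≡ E G y x)
          × (∀ x → E G x x ≡ false)
          × (∀ x y → E G x y ≡ true → V G x ≡ true)

_==_ : ∀ {n} → Fin n → Fin n → Bool
x == y = ⌊ x ≟ y ⌋

count : ∀ {n} → (Fin n → Bool) → ℕ
count {n} f = sum (map (λ x → if f x then 1 else 0) (allFin n))

isOdd : ℕ → Bool
isOdd zero = false
isOdd (suc k) = not (isOdd k)

pairSet : ∀ {n} → Fin n → Fin n → Fin n → Bool
pairSet a b x = (x == a) ∨ (x == b)

isPair : ∀ {n} → Fin n → Fin n → Fin n → Fin n → Bool
isPair a b x y = ((x == a) ∧ (y == b)) ∨ ((x == b) ∧ (y == a))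

deleteSet : ∀ {n} → Graph n → (Fin n → Bool) → Graph n
deleteSet G S = mkGraph (λ x → V G x ∧ not (S x))
                        (λ x y → E G x y ∧ not (S x) ∧ not (S y))

removeEdge : ∀ {n} → Graph n → Fin n → Fin n → Graph n
removeEdge G a b = mkGraph (V G) (λ x y → E G x y ∧ not (isPair a b x y))

addEdge : ∀ {n} → Graph n → Fin n → Fin n → Graph n
addEdge G a b = mkGraph (V G) (λ x y → E G x y ∨ isPair a b x y)

PerfectMatching : ∀ {n} → Graph n → Set
PerfectMatching {n} G =
  Σ (Fin n → Fin n → Bool) λ M →
      (∀ x y → M x y ≡ true → E G x y ≡ true)
    × (∀ x y → M x y ≡ M y x)
    × (∀ x → V G x ≡ true → Σ (Fin n) λ y → M x y ≡ true × (∀ z → M x z ≡ true → z ≡ y))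

Bicritical : ∀ {n} → Graph n → Set
Bicritical G = (4 ≤ count (V G))
             × (∀ a b → V G a ≡ true → V G b ≡ true → a ≢ b →
                  PerfectMatching (deleteSet G (pairSet a b)))

reach : ∀ {n} → Graph n → ℕ → Fin n → Fin n → Bool
reach G zero x y = V G x ∧ (x == y)
reach {n} G (suc k) x y = reach G k x y ∨ any (λ z → reach G k x z ∧ E G z y) (allFin n)

-- x and y lie in the same component (walks of length ≤ n suffice)
connectedTo : ∀ {n} → Graph n → Fin n → Fin n → Bool
connectedTo {n} G = reach G n

Connected : ∀ {n} → Graph n → Set
Connected G = ∀ x y → V G x ≡ true → V G y ≡ true → connectedTo G x y ≡ true

-- number of odd components: count the least vertex (in Fin order) of each
-- component whose vertex set has odd size.
isRep : ∀ {n} → Graph n → Fin n → Bool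
isRep {n} G x = V G x ∧ not (any (λ y → ⌊ y <? x ⌋ ∧ connectedTo G y x) (allFin n))

oddComponents : ∀ {n} → Graph n → ℕ
oddComponents G = count (λ x → isRep G x ∧ isOdd (count (connectedTo G x)))

Barrier : ∀ {n} → Graph n → (Fin n → Bool) → Set
Barrier G B = oddComponents (deleteSet G B) ≡ count B

TwoVertexCut : ∀ {n} → Graph n → Fin n → Fin n → Set
TwoVertexCut G u v = V G u ≡ true × V G v ≡ true × u ≢ v × ¬ Connected (deleteSet G (pairSet u v))

TwoSeparation : ∀ {n} → Graph n → Fin n → Fin n → Set
TwoSeparation G u v = TwoVertexCut G u v × ¬ Barrier G (pairSet u v)

IsK2 : ∀ {n} → Graph n → Set
IsK2 {n} H = count (V H) ≡ 2 × Σ (Fin n) λ x → Σ (Fin n) λ y → E H x y ≡ true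

Deletable : ∀ {n} → Graph n → Fin n → Fin n → Set
Deletable H x y = E H x y ≡ true × Bicritical (removeEdge H x y)

IsUV : ∀ {n} → Fin n → Fin n → Fin n → Fin n → Set
IsUV u v x y = isPair u v x y ≡ true

-- Conclusion of Lemma 3.2 for one side, with Gi = Gi' + uv (no-op if uv ∈ E(Gi')).
DEClaim : ∀ {n} → Graph n → Graph n → Fin n → Fin n → Set
DEClaim G Gi' u v =
    (E G u v ≡ false → ∀ x y →
        (Deletable Gi x y × ¬ IsUV u v x y) ⇔ (Deletable G x y × E Gi x y ≡ true))
  × (E G u v ≡ true → ∀ x y →
        (Deletable Gi x y ⊎ IsUV u v x y) ⇔ (Deletable G x y × E Gi x y ≡ true))
  where Gi = addEdge Gi' u v

-- Let {u, v} separate G into sides V₁ = V(G₁′) and V₂ = V(G₂′), with no edge between V₁ ∖ V₂ and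
-- V₂ ∖ V₁, and let Gᵢ = G[Vᵢ] + uv. Everything rests on parity. In a perfect matching of G - u - v
-- the interior V₂ ∖ V₁ is matched inside itself, so it has even size. Hence, for a, b ∈ V₁, a perfect
-- matching of G - a - b matches u and v either both into V₁, and then it restricts to G₁ - a - b, or
-- both into V₂ ∖ V₁, and then its V₁-part plus uv matches G₁ - a - b; matching only one of them out
-- would make (V₂ ∖ V₁) ∪ {u} or ∪ {v} a set of odd size closed under the matching. Conversely,
-- perfect matchings of G₁ - x - y, G₂ - u - v, G₁ - x - v, G₂ - y - u and of G₂ (avoiding uv)
-- glue to perfect matchings of G - x - y. So G is bicritical iff G₁ and G₂ are (both interiors being
-- nonempty, as G₁′, G₂′ are connected and not K₂). For an edge xy ≠ uv of G₁′ the sides of G - xy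
-- are G₁ - xy and G₂, and deleting uv does not change the sides at all; this gives both identities.

module Submission where

open import Defs
open import Data.Nat using (ℕ; zero; suc; _+_; _≤_; z≤n; s≤s)
import Data.Nat.Properties as ℕ
open import Data.Bool using (Bool; true; false; _∧_; _∨_; not; if_then_else_)
open import Data.Bool.Properties
  using (T-≡; ∧-comm; ∨-comm; not-involutive; ∧-identityʳ; ∧-zeroʳ; ¬-not; not-¬)
open import Data.Fin using (Fin; zero; suc)
open import Data.Fin.Properties using (_≟_; any?)
open import Data.List using (map; allFin; tabulate)
open import Data.List.Properties using (map-tabulate; map-cong)
open import Data.List.Relation.Unary.Any using (satisfied)
open import Data.List.Relation.Unary.Any.Properties using (any⁻)
open import Data.Nat.ListAction using (sum)
open import Data.Bool.ListAction using (any)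
open import Data.Product using (Σ; ∃; _×_; _,_; proj₁; proj₂)
open import Data.Sum using (_⊎_; inj₁; inj₂; [_,_]′)
import Data.Sum
open import Data.Empty using (⊥; ⊥-elim)
open import Relation.Nullary using (¬_; yes; no)
open import Relation.Nullary.Decidable using (isYes≗does; toSum)
open import Relation.Binary.PropositionalEquality
open import Function using (_∘_; id)
open import Function.Bundles using (_⇔_; mk⇔; Equivalence)

private variable
  n : ℕ

∧-elim : ∀ {a b} → a ∧ b ≡ true → a ≡ true × b ≡ true
∧-elim {true} {true} refl = refl , refl

∧-intro : ∀ {a b} → a ≡ true → b ≡ true → a ∧ b ≡ true
∧-intro refl refl = refl

∨-elim : ∀ {a b} → a ∨ b ≡ true → a ≡ true ⊎ b ≡ true
∨-elim {true} refl = inj₁ refl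
∨-elim {false} refl = inj₂ refl

∨-introˡ : ∀ {a} b → a ≡ true → a ∨ b ≡ true
∨-introˡ b refl = refl

∨-introʳ : ∀ a {b} → b ≡ true → a ∨ b ≡ true
∨-introʳ true refl = refl
∨-introʳ false refl = refl

not-true : ∀ {a} → not a ≡ true → a ≡ false
not-true {false} refl = refl

not-false : ∀ {a} → a ≡ false → not a ≡ true
not-false refl = refl

true≢false : ∀ {a} → a ≡ true → a ≡ false → ⊥
true≢false = not-¬

true-or-false : ∀ b → b ≡ true ⊎ b ≡ false
true-or-false true = inj₁ refl
true-or-false false = inj₂ refl

≡true-ext : ∀ {a b} → (a ≡ true → b ≡ true) → (b ≡ true → a ≡ true) → a ≡ b
≡true-ext {true} {true} f g = refl
≡true-ext {true} {false} f g = sym (f refl)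
≡true-ext {false} {true} f g = g refl
≡true-ext {false} {false} f g = refl

Subset : ℕ → Set
Subset n = Fin n → Bool

Rel : ℕ → Set
Rel n = Fin n → Fin n → Bool

infix 4 _∈_ _∉_ _⊆_ _⊆₂_
infixl 6 _∖_

_∈_ _∉_ : Fin n → Subset n → Set
x ∈ S = S x ≡ true
x ∉ S = S x ≡ false

_⊆_ : Subset n → Subset n → Set
S ⊆ T = ∀ x → x ∈ S → x ∈ T

_⊆₂_ : Rel n → Rel n → Set
R ⊆₂ R′ = ∀ x y → R x y ≡ true → R′ x y ≡ true

_∖_ : Subset n → Subset n → Subset n
(S ∖ D) x = S x ∧ not (D x)

⁅_⁆ : Fin n → Subset n
⁅ a ⁆ x = x == a

∈∖-intro : ∀ (S D : Subset n) {x} → x ∈ S → x ∉ D → x ∈ S ∖ D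
∈∖-intro S D x∈S x∉D = ∧-intro x∈S (not-false x∉D)

∈∖-elim : ∀ (S D : Subset n) {x} → x ∈ S ∖ D → x ∈ S × x ∉ D
∈∖-elim S D {x} e = let (x∈S , x∉D) = ∧-elim {S x} e in x∈S , not-true x∉D

==-true : ∀ {x y : Fin n} → x == y ≡ true → x ≡ y
==-true {x = x} {y} e with x ≟ y
... | yes x≡y = x≡y

==-refl : ∀ (x : Fin n) → x == x ≡ true
==-refl x with x ≟ x
... | yes _ = refl
... | no x≢x = ⊥-elim (x≢x refl)

==-false : ∀ {x y : Fin n} → x ≢ y → x == y ≡ false
==-false {x = x} {y} x≢y with x ≟ y
... | yes x≡y = ⊥-elim (x≢y x≡y)
... | no _ = refl

==-false⁻¹ : ∀ {x y : Fin n} → x == y ≡ false → x ≢ y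
==-false⁻¹ {x = x} e refl = true≢false (==-refl x) e

==-suc : ∀ (x y : Fin n) → (Fin.suc x == suc y) ≡ (x == y)
==-suc x y = trans (isYes≗does (suc x ≟ suc y)) (sym (isYes≗does (x ≟ y)))

∈pair-elim : ∀ (a b x : Fin n) → x ∈ pairSet a b → x ≡ a ⊎ x ≡ b
∈pair-elim a b x e with ∨-elim e
... | inj₁ x≡a = inj₁ (==-true x≡a)
... | inj₂ x≡b = inj₂ (==-true x≡b)

∈pairˡ : ∀ (a b : Fin n) → a ∈ pairSet a b
∈pairˡ a b rewrite ==-refl a = refl

∈pairʳ : ∀ (a b : Fin n) → b ∈ pairSet a b
∈pairʳ a b rewrite ==-refl b = ∨-introʳ (b == a) refl

∉pair : ∀ (a b x : Fin n) → x ≢ a → x ≢ b → x ∉ pairSet a b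
∉pair a b x x≢a x≢b rewrite ==-false x≢a | ==-false x≢b = refl

∉pair-elim : ∀ (a b x : Fin n) → x ∉ pairSet a b → x ≢ a × x ≢ b
∉pair-elim a b x e =
  (λ { refl → true≢false (∈pairˡ a b) e }) , (λ { refl → true≢false (∈pairʳ a b) e })

∈∖pair-intro : ∀ (W : Subset n) a b {x} → x ∈ W → x ≢ a → x ≢ b → x ∈ W ∖ pairSet a b
∈∖pair-intro W a b {x} x∈W x≢a x≢b = ∈∖-intro W (pairSet a b) x∈W (∉pair a b x x≢a x≢b)

∈∖pair-elim : ∀ (W : Subset n) a b {x} → x ∈ W ∖ pairSet a b → x ∈ W × x ≢ a × x ≢ b
∈∖pair-elim W a b {x} x∈ =
  let (x∈W , x∉ab) = ∈∖-elim W (pairSet a b) x∈ in x∈W , ∉pair-elim a b x x∉ab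

∉pair-of-∉ : ∀ (W : Subset n) {a b x} → a ∈ W → b ∈ W → x ∉ W → x ∉ pairSet a b
∉pair-of-∉ W {a} {b} {x} a∈W b∈W x∉W =
  ∉pair a b x (λ { refl → true≢false a∈W x∉W }) (λ { refl → true≢false b∈W x∉W })

data Pair (a b : Fin n) : Fin n → Fin n → Set where
  forward : Pair a b a b
  backward : Pair a b b a

isPair-elim : ∀ (a b x y : Fin n) → isPair a b x y ≡ true → Pair a b x y
isPair-elim a b x y e with ∨-elim {(x == a) ∧ (y == b)} e
... | inj₁ p with ∧-elim {x == a} p
...   | x≡a , y≡b with ==-true x≡a | ==-true y≡b
...     | refl | refl = forward
isPair-elim a b x y e | inj₂ q with ∧-elim {x == b} q
...   | x≡b , y≡a with ==-true x≡b | ==-true y≡a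
...     | refl | refl = backward

isPair-intro : ∀ {a b x y : Fin n} → Pair a b x y → isPair a b x y ≡ true
isPair-intro {a = a} {b} forward rewrite ==-refl a | ==-refl b = refl
isPair-intro {a = a} {b} backward rewrite ==-refl a | ==-refl b =
  ∨-introʳ ((b == a) ∧ (a == b)) refl

isPair-forward : ∀ (a b : Fin n) → isPair a b a b ≡ true
isPair-forward a b = isPair-intro {a = a} {b} forward

isPair-backward : ∀ (a b : Fin n) → isPair a b b a ≡ true
isPair-backward a b = isPair-intro {a = a} {b} backward

isPair-false : ∀ {a b x y : Fin n} → ¬ Pair a b x y → isPair a b x y ≡ false
isPair-false {a = a} {b} {x} {y} ¬p = ¬-not (¬p ∘ isPair-elim a b x y)

Pair-sym : ∀ {a b x y : Fin n} → Pair a b x y → Pair a b y x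
Pair-sym forward = backward
Pair-sym backward = forward

Pair-comm : ∀ {a b x y : Fin n} → Pair a b x y → Pair b a x y
Pair-comm forward = backward
Pair-comm backward = forward

Pair-trans : ∀ {a b x y p q : Fin n} → Pair a b x y → Pair x y p q → Pair a b p q
Pair-trans forward pq = pq
Pair-trans backward pq = Pair-comm pq

Pair-endpointˡ : ∀ {a b x y : Fin n} → Pair a b x y → x ≡ a ⊎ x ≡ b
Pair-endpointˡ forward = inj₁ refl
Pair-endpointˡ backward = inj₂ refl

Pair-endpointʳ : ∀ {a b x y : Fin n} → Pair a b x y → y ≡ a ⊎ y ≡ b
Pair-endpointʳ = Pair-endpointˡ ∘ Pair-sym

Pair-touchesˡ : ∀ {a b x y : Fin n} → Pair a b x y → x ≡ a ⊎ y ≡ a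
Pair-touchesˡ forward = inj₁ refl
Pair-touchesˡ backward = inj₂ refl

Pair-flip : ∀ {a b x y : Fin n} → Pair a b x y → Pair x y a b
Pair-flip forward = forward
Pair-flip backward = backward

Pair-of-endpoints : ∀ {a b x y : Fin n} →
  x ≡ a ⊎ x ≡ b → y ≡ a ⊎ y ≡ b → x ≢ y → Pair a b x y
Pair-of-endpoints (inj₁ refl) (inj₁ refl) x≢y = ⊥-elim (x≢y refl)
Pair-of-endpoints (inj₁ refl) (inj₂ refl) x≢y = forward
Pair-of-endpoints (inj₂ refl) (inj₁ refl) x≢y = backward
Pair-of-endpoints (inj₂ refl) (inj₂ refl) x≢y = ⊥-elim (x≢y refl)

Pair-dec : ∀ (a b x y : Fin n) → Pair a b x y ⊎ ¬ Pair a b x y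
Pair-dec a b x y =
  [ inj₁ ∘ isPair-elim a b x y , (λ ¬ab → inj₂ λ p → true≢false (isPair-intro p) ¬ab) ]′
    (true-or-false (isPair a b x y))

isPair-sym : ∀ (a b x y : Fin n) → isPair a b x y ≡ isPair a b y x
isPair-sym a b x y = ≡true-ext (isPair-intro ∘ Pair-sym ∘ isPair-elim a b x y)
                               (isPair-intro ∘ Pair-sym ∘ isPair-elim a b y x)

-- Counting

indicator : Bool → ℕ
indicator b = if b then 1 else 0

count-suc : ∀ (S : Subset (suc n)) → count S ≡ indicator (S zero) + count (S ∘ suc)
count-suc {n} S = cong (indicator (S zero) +_) (cong sum (begin
    map χ (tabulate suc)       ≡⟨ map-tabulate suc χ ⟩
    tabulate (χ ∘ suc)         ≡⟨ sym (map-tabulate id (χ ∘ suc)) ⟩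
    map (χ ∘ suc) (allFin n)   ∎))
  where
  open ≡-Reasoning
  χ : Fin (suc n) → ℕ
  χ x = indicator (S x)

count-cong : ∀ {S T : Subset n} → (∀ x → S x ≡ T x) → count S ≡ count T
count-cong {n} S≗T = cong sum (map-cong (cong indicator ∘ S≗T) (allFin n))

count-empty : ∀ (S : Subset n) → (∀ x → x ∉ S) → count S ≡ 0
count-empty {zero} S _ = refl
count-empty {suc n} S empty =
  trans (count-suc S)
        (cong₂ _+_ (cong indicator (empty zero)) (count-empty (S ∘ suc) (empty ∘ suc)))

count-remove : ∀ (S : Subset n) {a} → a ∈ S → count S ≡ suc (count (S ∖ ⁅ a ⁆))
count-remove {suc n} S {zero} a∈S = begin
  count S
    ≡⟨ count-suc S ⟩
  indicator (S zero) + count (S ∘ suc)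
    ≡⟨ cong (λ b → indicator b + count (S ∘ suc)) a∈S ⟩
  suc (count (S ∘ suc))
    ≡⟨ cong suc (count-cong (sym ∘ ∧-identityʳ ∘ S ∘ suc)) ⟩
  suc (count (S∖0 ∘ suc))
    ≡⟨ cong (λ b → suc (indicator b + count (S∖0 ∘ suc))) (sym (∧-zeroʳ (S zero))) ⟩
  suc (indicator (S zero ∧ false) + count (S∖0 ∘ suc))
    ≡⟨ cong suc (sym (count-suc S∖0)) ⟩
  suc (count S∖0)
    ∎
  where
  open ≡-Reasoning
  S∖0 = S ∖ ⁅ zero ⁆
count-remove {suc n} S {suc a} a∈S = begin
  count S
    ≡⟨ count-suc S ⟩
  indicator (S zero) + count (S ∘ suc)
    ≡⟨ cong (indicator (S zero) +_) (count-remove (S ∘ suc) a∈S) ⟩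
  indicator (S zero) + suc (count ((S ∘ suc) ∖ ⁅ a ⁆))
    ≡⟨ ℕ.+-suc (indicator (S zero)) _ ⟩
  suc (indicator (S zero) + count ((S ∘ suc) ∖ ⁅ a ⁆))
    ≡⟨ cong suc (cong₂ _+_ (cong indicator (sym (∧-identityʳ (S zero)))) (count-cong shift)) ⟩
  suc (indicator (S zero ∧ true) + count (S∖a ∘ suc))
    ≡⟨ cong suc (sym (count-suc S∖a)) ⟩
  suc (count S∖a)
    ∎
  where
  open ≡-Reasoning
  S∖a = S ∖ ⁅ suc a ⁆
  shift : ∀ x → ((S ∘ suc) ∖ ⁅ a ⁆) x ≡ (S∖a ∘ suc) x
  shift x = cong (λ b → S (suc x) ∧ not b) (sym (==-suc x a))

∃∈-or-empty : ∀ (S : Subset n) → (∃ λ x → x ∈ S) ⊎ (∀ x → x ∉ S)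
∃∈-or-empty S with any? (λ x → S x Data.Bool.≟ true)
... | yes ∃x = inj₁ ∃x
... | no ∄x = inj₂ λ x → ¬-not (λ x∈S → ∄x (x , x∈S))

-- Perfect matchings of a vertex set

infixr 6 _∪_ _∪₂_
infixl 7 _⇂_

_∪_ : Subset n → Subset n → Subset n
(S ∪ T) x = S x ∨ T x

_∪₂_ : Rel n → Rel n → Rel n
(R ∪₂ R′) x y = R x y ∨ R′ x y

_⇂_ : Rel n → Subset n → Rel n
(M ⇂ T) x y = M x y ∧ T x

Irreflexive : Rel n → Set
Irreflexive M = ∀ a → M a a ≡ false

UniquePartner : Rel n → Fin n → Set
UniquePartner M a = ∃ λ b → M a b ≡ true × ∀ c → M a c ≡ true → c ≡ b

record PerfectOn (T : Subset n) (M : Rel n) : Set where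
  field
    symmetric : ∀ a b → M a b ≡ M b a
    support : ∀ {a b} → M a b ≡ true → a ∈ T
    partner : ∀ a → a ∈ T → UniquePartner M a

  matched-sym : ∀ {a b} → M a b ≡ true → M b a ≡ true
  matched-sym {a} {b} e = trans (sym (symmetric a b)) e

  supportʳ : ∀ {a b} → M a b ≡ true → b ∈ T
  supportʳ = support ∘ matched-sym

  partner-unique : ∀ {a b c} → M a b ≡ true → M a c ≡ true → b ≡ c
  partner-unique {a} {b} {c} ab ac =
    let (_ , _ , unique) = partner a (support ab) in trans (unique b ab) (sym (unique c ac))

open PerfectOn

PerfectOn-resp : ∀ {S T : Subset n} {M} → (∀ x → S x ≡ T x) → PerfectOn S M → PerfectOn T M
PerfectOn-resp S≗T P = record
  { symmetric = symmetric P
  ; support = λ e → trans (sym (S≗T _)) (support P e)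
  ; partner = λ a a∈T → partner P a (trans (S≗T a) a∈T)
  }

PerfectOn-restrict : ∀ {S : Subset n} {M} (T : Subset n) → PerfectOn S M →
  (∀ a b → M a b ≡ true → a ∈ T → b ∈ T) → T ⊆ S → PerfectOn T (M ⇂ T)
PerfectOn-restrict {M = M} T P closed T⊆S = record
  { symmetric = λ a b → ≡true-ext (flip a b) (flip b a)
  ; support = proj₂ ∘ ∧-elim
  ; partner = λ a a∈T →
      let (b , ab , unique) = partner P a (T⊆S a a∈T) in
      b , ∧-intro ab a∈T , λ c e → unique c (proj₁ (∧-elim e))
  }
  where
  flip : ∀ a b → (M ⇂ T) a b ≡ true → (M ⇂ T) b a ≡ true
  flip a b e = let (ab , a∈T) = ∧-elim e in ∧-intro (matched-sym P ab) (closed a b ab a∈T)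

PerfectOn-union : ∀ {S₁ S₂ : Subset n} {M₁ M₂} → PerfectOn S₁ M₁ → PerfectOn S₂ M₂ →
  (∀ x → x ∈ S₁ → x ∈ S₂ → ⊥) → PerfectOn (S₁ ∪ S₂) (M₁ ∪₂ M₂)
PerfectOn-union {S₁ = S₁} {S₂} {M₁} {M₂} P₁ P₂ disjoint = record
  { symmetric = λ a b → cong₂ _∨_ (symmetric P₁ a b) (symmetric P₂ a b)
  ; support = λ {a} e →
      [ ∨-introˡ (S₂ a) ∘ support P₁ , ∨-introʳ (S₁ a) ∘ support P₂ ]′ (∨-elim e)
  ; partner = λ a a∈S → [ partner₁ a , partner₂ a ]′ (∨-elim a∈S)
  }
  where
  partner₁ : ∀ a → a ∈ S₁ → UniquePartner (M₁ ∪₂ M₂) a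
  partner₁ a a∈S₁ =
    let (b , ab , unique) = partner P₁ a a∈S₁ in
    b , ∨-introˡ (M₂ a b) ab ,
    λ c e → [ unique c , (λ ac → ⊥-elim (disjoint a a∈S₁ (support P₂ ac))) ]′ (∨-elim e)
  partner₂ : ∀ a → a ∈ S₂ → UniquePartner (M₁ ∪₂ M₂) a
  partner₂ a a∈S₂ =
    let (b , ab , unique) = partner P₂ a a∈S₂ in
    b , ∨-introʳ (M₁ a b) ab ,
    λ c e → [ (λ ac → ⊥-elim (disjoint a (support P₁ ac) a∈S₂)) , unique c ]′ (∨-elim e)

PerfectOn-pair : ∀ {a b : Fin n} → a ≢ b → PerfectOn (pairSet a b) (isPair a b)
PerfectOn-pair {a = a} {b} a≢b = record
  { symmetric = isPair-sym a b
  ; support = λ {x} {y} e → pair-member (isPair-elim a b x y e)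
  ; partner = λ x x∈ab → [ partner-a x , partner-b x ]′ (∈pair-elim a b x x∈ab)
  }
  where
  pair-member : ∀ {x y} → Pair a b x y → x ∈ pairSet a b
  pair-member forward = ∈pairˡ a b
  pair-member backward = ∈pairʳ a b
  partner-a : ∀ x → x ≡ a → UniquePartner (isPair a b) x
  partner-a x refl = b , isPair-forward a b , λ c e → unique (isPair-elim a b a c e)
    where
    unique : ∀ {c} → Pair a b a c → c ≡ b
    unique forward = refl
    unique backward = ⊥-elim (a≢b refl)
  partner-b : ∀ x → x ≡ b → UniquePartner (isPair a b) x
  partner-b x refl = a , isPair-backward a b , λ c e → unique (isPair-elim a b b c e)
    where
    unique : ∀ {c} → Pair a b b c → c ≡ a
    unique forward = ⊥-elim (a≢b refl)
    unique backward = refl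

⇂-irreflexive : ∀ (M : Rel n) (T : Subset n) → Irreflexive M → Irreflexive (M ⇂ T)
⇂-irreflexive M T irr a rewrite irr a = refl

⊆₂-irreflexive : ∀ {M R : Rel n} → M ⊆₂ R → Irreflexive R → Irreflexive M
⊆₂-irreflexive M⊆R irr a = ¬-not λ aa → true≢false (M⊆R a a aa) (irr a)

PerfectOn-add-pair : ∀ {W : Subset n} {M a b} → a ∈ W → b ∈ W → a ≢ b →
  PerfectOn (W ∖ pairSet a b) M → PerfectOn W (M ∪₂ isPair a b)
PerfectOn-add-pair {W = W} {a = a} {b} a∈W b∈W a≢b P =
  PerfectOn-resp (λ x → ≡true-ext to (from x)) (PerfectOn-union P (PerfectOn-pair a≢b) disjoint)
  where
  disjoint : ∀ x → x ∈ W ∖ pairSet a b → x ∈ pairSet a b → ⊥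
  disjoint x x∈ x∈ab = true≢false x∈ab (proj₂ (∈∖-elim W (pairSet a b) x∈))
  to : ∀ {x} → x ∈ (W ∖ pairSet a b) ∪ pairSet a b → x ∈ W
  to {x} x∈ with ∨-elim {(W ∖ pairSet a b) x} x∈
  ... | inj₁ x∈W∖ab = proj₁ (∈∖-elim W (pairSet a b) x∈W∖ab)
  ... | inj₂ x∈ab with ∈pair-elim a b x x∈ab
  ...   | inj₁ refl = a∈W
  ...   | inj₂ refl = b∈W
  from : ∀ x → x ∈ W → x ∈ (W ∖ pairSet a b) ∪ pairSet a b
  from x x∈W with true-or-false (pairSet a b x)
  ... | inj₁ x∈ab = ∨-introʳ ((W ∖ pairSet a b) x) x∈ab
  ... | inj₂ x∉ab = ∨-introˡ (pairSet a b x) (∈∖-intro W (pairSet a b) x∈W x∉ab)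

∈-of-count≡suc : ∀ (S : Subset n) {k} → count S ≡ suc k → ∃ λ x → x ∈ S
∈-of-count≡suc S cS with ∃∈-or-empty S
... | inj₁ ∃x = ∃x
... | inj₂ empty with trans (sym (count-empty S empty)) cS
...   | ()

PerfectOn-drop-pair : ∀ {T : Subset n} {M k} → PerfectOn T M → Irreflexive M →
  count T ≡ suc k → Σ (Subset n) λ T′ → count T ≡ suc (suc (count T′)) × PerfectOn T′ (M ⇂ T′)
PerfectOn-drop-pair {n} {T} {M} P irr cT = T′ , count-T , PerfectOn-restrict T′ P closed T′⊆T
  where
  a = proj₁ (∈-of-count≡suc T cT)
  a∈T = proj₂ (∈-of-count≡suc T cT)
  b = proj₁ (partner P a a∈T)
  ab : M a b ≡ true
  ab = proj₁ (proj₂ (partner P a a∈T))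
  b≢a : b ≢ a
  b≢a b≡a = true≢false (subst (λ c → M a c ≡ true) b≡a ab) (irr a)
  T′ : Subset n
  T′ = (T ∖ ⁅ a ⁆) ∖ ⁅ b ⁆
  ∈T′ : ∀ {x} → x ∈ T → x ≢ a → x ≢ b → x ∈ T′
  ∈T′ x∈T x≢a x≢b =
    ∈∖-intro (T ∖ ⁅ a ⁆) ⁅ b ⁆ (∈∖-intro T ⁅ a ⁆ x∈T (==-false x≢a)) (==-false x≢b)
  ∈T′-elim : ∀ {x} → x ∈ T′ → x ∈ T × x ≢ a × x ≢ b
  ∈T′-elim x∈T′ =
    let (x∈T∖a , x∉b) = ∈∖-elim (T ∖ ⁅ a ⁆) ⁅ b ⁆ x∈T′
        (x∈T , x∉a) = ∈∖-elim T ⁅ a ⁆ x∈T∖a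
    in x∈T , ==-false⁻¹ x∉a , ==-false⁻¹ x∉b
  count-T : count T ≡ suc (suc (count T′))
  count-T = trans (count-remove T a∈T) (cong suc (count-remove (T ∖ ⁅ a ⁆) b∈T∖a))
    where b∈T∖a = ∈∖-intro T ⁅ a ⁆ (supportʳ P ab) (==-false b≢a)
  T′⊆T : T′ ⊆ T
  T′⊆T x = proj₁ ∘ ∈T′-elim
  closed : ∀ x y → M x y ≡ true → x ∈ T′ → y ∈ T′
  closed x y xy x∈T′ =
    let (_ , x≢a , x≢b) = ∈T′-elim x∈T′ in
    ∈T′ (supportʳ P xy)
        (λ { refl → x≢b (partner-unique P (matched-sym P xy) ab) })
        (λ { refl → x≢a (partner-unique P (matched-sym P xy) (matched-sym P ab)) })

PerfectOn⇒even : ∀ {T : Subset n} {M k} → PerfectOn T M → Irreflexive M →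
  count T ≡ k → isOdd k ≡ false
PerfectOn⇒even {k = zero} _ _ _ = refl
PerfectOn⇒even {k = suc zero} P irr cT with PerfectOn-drop-pair P irr cT
... | _ , cT′ , _ with trans (sym cT′) cT
...   | ()
PerfectOn⇒even {M = M} {k = suc (suc k)} P irr cT with PerfectOn-drop-pair P irr cT
... | T′ , cT′ , P′ =
  trans (not-involutive (isOdd k)) (PerfectOn⇒even P′ (⇂-irreflexive M T′ irr) cT′′)
  where
  cT′′ : count T′ ≡ k
  cT′′ = ℕ.suc-injective (ℕ.suc-injective (trans (sym cT′) cT))

IsGraph-edge : ∀ {K : Graph n} → IsGraph K → ∀ {x y} → E K x y ≡ true → x ∈ V K × y ∈ V K
IsGraph-edge (sym , _ , edge-vertex) {x} {y} e =
  edge-vertex x y e , edge-vertex y x (trans (sym y x) e)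

IsGraph-Pair : ∀ {K : Graph n} → IsGraph K → ∀ {x y p q} →
  E K x y ≡ true → Pair x y p q → E K p q ≡ true
IsGraph-Pair _ e forward = e
IsGraph-Pair (sym , _) {x} {y} e backward = trans (sym y x) e

IsGraph-≢ : ∀ {K : Graph n} → IsGraph K → ∀ {x y} → E K x y ≡ true → x ≢ y
IsGraph-≢ (_ , irrefl , _) {x} e refl = true≢false e (irrefl x)

any-witness : ∀ {A : Set} (p : A → Bool) xs → any p xs ≡ true → ∃ λ z → p z ≡ true
any-witness p xs e =
  let (z , pz) = satisfied (any⁻ p xs (Equivalence.from T-≡ e)) in z , Equivalence.to T-≡ pz

reach-edge : ∀ (K : Graph n) k {x y} → reach K k x y ≡ true → x ≢ y → ∃ λ z → E K z y ≡ true
reach-edge K zero {x} e x≢y = ⊥-elim (x≢y (==-true (proj₂ (∧-elim {V K x} e))))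
reach-edge {n} K (suc k) {x} {y} e x≢y with ∨-elim {reach K k x y} e
... | inj₁ r = reach-edge K k r x≢y
... | inj₂ r =
  let (z , xz-yz) = any-witness (λ z → reach K k x z ∧ E K z y) (allFin n) r in
  z , proj₂ (∧-elim {reach K k x z} xz-yz)

Connected⇒edge : ∀ {K : Graph n} → Connected K → ∀ {x y} → x ∈ V K → y ∈ V K → x ≢ y →
  ∃ λ z → E K z y ≡ true
Connected⇒edge {n} {K} conn {x} {y} x∈V y∈V = reach-edge K n (conn x y x∈V y∈V)

EdgesHaveVertices : Graph n → Set
EdgesHaveVertices K = ∀ x y → E K x y ≡ true → x ∈ V K

PerfectMatching-elim : ∀ (K : Graph n) (D : Subset n) → EdgesHaveVertices K →
  PerfectMatching (deleteSet K D) → ∃ λ M → PerfectOn (V K ∖ D) M × M ⊆₂ E K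
PerfectMatching-elim K D edge-vertex (M , M⊆E , symmetric , partner) =
  M , record { symmetric = symmetric ; support = matched⇒alive ; partner = partner } , M⊆EK
  where
  M⊆EK : M ⊆₂ E K
  M⊆EK x y = proj₁ ∘ ∧-elim {E K x y} ∘ M⊆E x y
  matched⇒alive : ∀ {a b} → M a b ≡ true → a ∈ V K ∖ D
  matched⇒alive {a} {b} ab =
    let (ab∈E , ab∉D) = ∧-elim {E K a b} (M⊆E a b ab) in
    ∧-intro (edge-vertex a b ab∈E) (proj₁ (∧-elim {not (D a)} ab∉D))

PerfectMatching-intro : ∀ (K : Graph n) (D : Subset n) {S M} → PerfectOn S M →
  V K ∖ D ⊆ S → (∀ x → x ∈ S → x ∉ D) → M ⊆₂ E K → PerfectMatching (deleteSet K D)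
PerfectMatching-intro K D P covers avoids M⊆E =
  _ , (λ x y xy → ∧-intro (M⊆E x y xy) (∧-intro (not-false (avoids x (support P xy)))
                                                  (not-false (avoids y (supportʳ P xy))))) ,
  symmetric P , λ x x∈V → partner P x (covers x x∈V)

Bicritical-mono : ∀ (K K′ : Graph n) → (∀ x → V K x ≡ V K′ x) → E K ⊆₂ E K′ →
  Bicritical K → Bicritical K′
Bicritical-mono K K′ V≗ E⊆ (four , matchable) =
  subst (4 ≤_) (count-cong V≗) four ,
  λ a b a∈V b∈V a≢b → transport (matchable a b (trans (V≗ a) a∈V) (trans (V≗ b) b∈V) a≢b)
  where
  transport : ∀ {D} → PerfectMatching (deleteSet K D) → PerfectMatching (deleteSet K′ D)
  transport {D} (M , M⊆E , symmetric , partner) =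
      M , (λ x y xy → let (e , rest) = ∧-elim {E K x y} (M⊆E x y xy) in ∧-intro (E⊆ x y e) rest) ,
    symmetric , λ x x∈V → partner x (subst (λ c → c ∧ not (D x) ≡ true) (sym (V≗ x)) x∈V)

-- Separations at {u, v}

induced+ : Graph n → Subset n → Fin n → Fin n → Graph n
induced+ H W u v = mkGraph W (λ x y → (E H x y ∧ W x ∧ W y) ∨ isPair u v x y)

record Separation (n : ℕ) : Set where
  field
    H : Graph n
    V₁ V₂ : Subset n
    u v : Fin n
    V-split : ∀ x → V H x ≡ (V₁ ∪ V₂) x
    V-meet : ∀ x → x ∈ V₁ → x ∈ V₂ → x ≡ u ⊎ x ≡ v
    u∈V₁ : u ∈ V₁
    u∈V₂ : u ∈ V₂
    v∈V₁ : v ∈ V₁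
    v∈V₂ : v ∈ V₂
    u≢v : u ≢ v
    E-inside₁ : ∀ x y → E H x y ≡ true → x ∉ V₂ → y ∈ V₁
    E-inside₂ : ∀ x y → E H x y ≡ true → x ∉ V₁ → y ∈ V₂
    E-sym : ∀ x y → E H x y ≡ E H y x
    E-irrefl : Irreflexive (E H)
    E-vertex : EdgesHaveVertices H

swap : Separation n → Separation n
swap S = record
  { H = H ; V₁ = V₂ ; V₂ = V₁ ; u = u ; v = v
  ; V-split = λ x → trans (V-split x) (∨-comm (V₁ x) (V₂ x))
  ; V-meet = λ x x∈V₂ x∈V₁ → V-meet x x∈V₁ x∈V₂
  ; u∈V₁ = u∈V₂ ; u∈V₂ = u∈V₁ ; v∈V₁ = v∈V₂ ; v∈V₂ = v∈V₁ ; u≢v = u≢v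
  ; E-inside₁ = E-inside₂ ; E-inside₂ = E-inside₁
  ; E-sym = E-sym ; E-irrefl = E-irrefl ; E-vertex = E-vertex
  }
  where open Separation S

module _ {n} (S : Separation n) where
  open Separation S

  inner₁ : Subset n
  inner₁ = V₁ ∖ V₂

  side₁ : Graph n
  side₁ = induced+ H V₁ u v

  ∈V-elim : ∀ {x} → x ∈ V H → x ∈ V₁ ⊎ x ∈ V₂
  ∈V-elim {x} x∈V = ∨-elim {V₁ x} (trans (sym (V-split x)) x∈V)

  ∈V₂-of-∉V₁ : ∀ {x} → x ∈ V H → x ∉ V₁ → x ∈ V₂
  ∈V₂-of-∉V₁ x∈V x∉V₁ = [ (λ x∈V₁ → ⊥-elim (true≢false x∈V₁ x∉V₁)) , id ]′ (∈V-elim x∈V)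

  V₁⊆V : V₁ ⊆ V H
  V₁⊆V x x∈V₁ = trans (V-split x) (∨-introˡ (V₂ x) x∈V₁)

  ∉V₂ : ∀ {x} → x ∈ V₁ → x ≢ u → x ≢ v → x ∉ V₂
  ∉V₂ {x} x∈V₁ x≢u x≢v = ¬-not λ x∈V₂ → [ x≢u , x≢v ]′ (V-meet x x∈V₁ x∈V₂)

  ∉V₂⇒≢u : ∀ {x} → x ∉ V₂ → x ≢ u
  ∉V₂⇒≢u x∉V₂ refl = true≢false u∈V₂ x∉V₂

  ∉V₂⇒≢v : ∀ {x} → x ∉ V₂ → x ≢ v
  ∉V₂⇒≢v x∉V₂ refl = true≢false v∈V₂ x∉V₂

  Pair-∈V₁ : ∀ {w w′} → Pair u v w w′ → w ∈ V₁
  Pair-∈V₁ forward = u∈V₁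
  Pair-∈V₁ backward = v∈V₁

  V-meet-Pair : ∀ {w w′} → Pair u v w w′ → ∀ x → x ∈ V₁ → x ∈ V₂ → x ≡ w ⊎ x ≡ w′
  V-meet-Pair forward x x∈V₁ x∈V₂ = V-meet x x∈V₁ x∈V₂
  V-meet-Pair backward x x∈V₁ x∈V₂ = Data.Sum.swap (V-meet x x∈V₁ x∈V₂)

  inner₁-elim : ∀ {x} → x ∈ inner₁ → x ∈ V₁ × x ∉ V₂
  inner₁-elim = ∈∖-elim V₁ V₂

  inner₁∖-intro : ∀ (D : Subset n) {x} → x ∈ V₁ → x ∉ V₂ → x ∉ D → x ∈ inner₁ ∖ D
  inner₁∖-intro D x∈V₁ x∉V₂ x∉D = ∈∖-intro inner₁ D (∈∖-intro V₁ V₂ x∈V₁ x∉V₂) x∉D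

  inner₁∖-elim : ∀ (D : Subset n) {x} → x ∈ inner₁ ∖ D → x ∈ V₁ × x ∉ V₂ × x ∉ D
  inner₁∖-elim D x∈ =
    let (x∈inner , x∉D) = ∈∖-elim inner₁ D x∈ ; (x∈V₁ , x∉V₂) = inner₁-elim x∈inner in
    x∈V₁ , x∉V₂ , x∉D

  side₁-edge-V₁ : ∀ x y → E side₁ x y ≡ true → x ∈ V₁
  side₁-edge-V₁ x y e with ∨-elim {E H x y ∧ V₁ x ∧ V₁ y} e
  ... | inj₁ h = proj₁ (∧-elim {V₁ x} (proj₂ (∧-elim {E H x y} h)))
  ... | inj₂ p with isPair-elim u v x y p
  ...   | forward = u∈V₁
  ...   | backward = v∈V₁

  side₁-edge-H : ∀ x y → E side₁ x y ≡ true → ¬ Pair u v x y → E H x y ≡ true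
  side₁-edge-H x y e ¬uv with ∨-elim {E H x y ∧ V₁ x ∧ V₁ y} e
  ... | inj₁ h = proj₁ (∧-elim {E H x y} h)
  ... | inj₂ p = ⊥-elim (¬uv (isPair-elim u v x y p))

  H-edge⇒side₁ : ∀ {x y} → E H x y ≡ true → x ∈ V₁ → y ∈ V₁ → E side₁ x y ≡ true
  H-edge⇒side₁ {x} {y} e x∈V₁ y∈V₁ = ∨-introˡ (isPair u v x y) (∧-intro e (∧-intro x∈V₁ y∈V₁))

  side₁-irrefl : Irreflexive (E side₁)
  side₁-irrefl x = ¬-not λ xx → [ (λ xx∈E → true≢false xx∈E (E-irrefl x)) , loop ]′ (edge-or-uv xx)
    where
    edge-or-uv : E side₁ x x ≡ true → E H x x ≡ true ⊎ Pair u v x x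
    edge-or-uv xx = [ inj₁ ∘ proj₁ ∘ ∧-elim {E H x x} , inj₂ ∘ isPair-elim u v x x ]′
                      (∨-elim {E H x x ∧ V₁ x ∧ V₁ x} xx)
    loop : Pair u v x x → ⊥
    loop forward = u≢v refl
    loop backward = u≢v refl

  inner₁-even : PerfectMatching (deleteSet H (pairSet u v)) → isOdd (count inner₁) ≡ false
  inner₁-even pm =
    PerfectOn⇒even (PerfectOn-restrict inner₁ P closed inner₁⊆alive)
                   (⇂-irreflexive M inner₁ (⊆₂-irreflexive M⊆E E-irrefl)) refl
    where
    M : Rel n
    M = proj₁ (PerfectMatching-elim H (pairSet u v) E-vertex pm)
    P : PerfectOn (V H ∖ pairSet u v) M
    P = proj₁ (proj₂ (PerfectMatching-elim H (pairSet u v) E-vertex pm))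
    M⊆E : M ⊆₂ E H
    M⊆E = proj₂ (proj₂ (PerfectMatching-elim H (pairSet u v) E-vertex pm))
    closed : ∀ a b → M a b ≡ true → a ∈ inner₁ → b ∈ inner₁
    closed a b ab a∈inner =
      let b∈V₁ = E-inside₁ a b (M⊆E a b ab) (proj₂ (inner₁-elim a∈inner))
          (_ , b≢u , b≢v) = ∈∖pair-elim (V H) u v (supportʳ P ab)
      in ∈∖-intro V₁ V₂ b∈V₁ (∉V₂ b∈V₁ b≢u b≢v)
    inner₁⊆alive : inner₁ ⊆ V H ∖ pairSet u v
    inner₁⊆alive x x∈inner =
      let (x∈V₁ , x∉V₂) = inner₁-elim x∈inner in
      ∈∖pair-intro (V H) u v (V₁⊆V x x∈V₁) (∉V₂⇒≢u x∉V₂) (∉V₂⇒≢v x∉V₂)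

  count-V₁ : count V₁ ≡ suc (suc (count inner₁))
  count-V₁ = begin
    count V₁                                ≡⟨ count-remove V₁ u∈V₁ ⟩
    suc (count (V₁ ∖ ⁅ u ⁆))                ≡⟨ cong suc (count-remove (V₁ ∖ ⁅ u ⁆) v∈V₁∖u) ⟩
    suc (suc (count (V₁ ∖ ⁅ u ⁆ ∖ ⁅ v ⁆)))  ≡⟨ cong (λ k → suc (suc k)) (count-cong same) ⟩
    suc (suc (count inner₁))                ∎
    where
    open ≡-Reasoning
    v∈V₁∖u : v ∈ V₁ ∖ ⁅ u ⁆
    v∈V₁∖u = ∈∖-intro V₁ ⁅ u ⁆ v∈V₁ (==-false (u≢v ∘ sym))
    to : ∀ {x} → x ∈ V₁ ∖ ⁅ u ⁆ ∖ ⁅ v ⁆ → x ∈ inner₁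
    to x∈ =
      let (x∈V₁∖u , x∉v) = ∈∖-elim (V₁ ∖ ⁅ u ⁆) ⁅ v ⁆ x∈ ; (x∈V₁ , x∉u) = ∈∖-elim V₁ ⁅ u ⁆ x∈V₁∖u in
      ∈∖-intro V₁ V₂ x∈V₁ (∉V₂ x∈V₁ (==-false⁻¹ x∉u) (==-false⁻¹ x∉v))
    from : ∀ {x} → x ∈ inner₁ → x ∈ V₁ ∖ ⁅ u ⁆ ∖ ⁅ v ⁆
    from x∈inner =
      let (x∈V₁ , x∉V₂) = inner₁-elim x∈inner in
      ∈∖-intro (V₁ ∖ ⁅ u ⁆) ⁅ v ⁆ (∈∖-intro V₁ ⁅ u ⁆ x∈V₁ (==-false (∉V₂⇒≢u x∉V₂)))
                                 (==-false (∉V₂⇒≢v x∉V₂))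
    same : ∀ x → (V₁ ∖ ⁅ u ⁆ ∖ ⁅ v ⁆) x ≡ inner₁ x
    same x = ≡true-ext (to {x}) (from {x})

≥2-of-even : ∀ {k m} → isOdd k ≡ false → k ≡ suc m → 2 ≤ k
≥2-of-even {zero} _ ()
≥2-of-even {suc zero} () _
≥2-of-even {suc (suc k)} _ _ = s≤s (s≤s z≤n)

-- Sides of a separation of a bicritical graph

module _ {n} (S : Separation n) (bic : Bicritical (Separation.H S)) where
  open Separation S

  H-minus-uv : PerfectMatching (deleteSet H (pairSet u v))
  H-minus-uv = proj₂ bic u v (V₁⊆V S u u∈V₁) (V₁⊆V S v v∈V₁) u≢v

  side₁-four : (∃ λ a → a ∈ inner₁ S) → 4 ≤ count V₁
  side₁-four (a , a∈inner) rewrite count-V₁ S =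
    s≤s (s≤s (≥2-of-even (inner₁-even S H-minus-uv) (count-remove (inner₁ S) a∈inner)))

  module SideMatching {a b} (a∈V₁ : a ∈ V₁) (b∈V₁ : b ∈ V₁) (a≢b : a ≢ b) where
    D : Subset n
    D = pairSet a b

    H-minus-ab =
      PerfectMatching-elim H D E-vertex (proj₂ bic a b (V₁⊆V S a a∈V₁) (V₁⊆V S b b∈V₁) a≢b)

    M : Rel n
    M = proj₁ H-minus-ab
    P : PerfectOn (V H ∖ D) M
    P = proj₁ (proj₂ H-minus-ab)
    M⊆E : M ⊆₂ E H
    M⊆E = proj₂ (proj₂ H-minus-ab)

    alive : ∀ {x y} → M x y ≡ true → x ∈ V H × x ∉ D
    alive = ∈∖-elim (V H) D ∘ support P

    ∉V₁⇒∉D : ∀ {x} → x ∉ V₁ → x ∉ D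
    ∉V₁⇒∉D = ∉pair-of-∉ V₁ a∈V₁ b∈V₁

    M-irrefl : ∀ T → Irreflexive (M ⇂ T)
    M-irrefl T = ⇂-irreflexive M T (⊆₂-irreflexive M⊆E E-irrefl)

    MatchedInside MatchedOutside : Fin n → Set
    MatchedInside w = ∀ z → M w z ≡ true → z ∈ V₁
    MatchedOutside w = ∃ λ p → M w p ≡ true × p ∉ V₁

    inside-or-outside : ∀ w → w ∈ V₁ → MatchedInside w ⊎ MatchedOutside w
    inside-or-outside w w∈V₁ with true-or-false (D w)
    ... | inj₁ w∈D = inj₁ λ z wz → ⊥-elim (true≢false w∈D (proj₂ (alive wz)))
    ... | inj₂ w∉D with partner P w (∈∖-intro (V H) D (V₁⊆V S w w∈V₁) w∉D)
    ...   | p , wp , unique with true-or-false (V₁ p)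
    ...     | inj₁ p∈V₁ = inj₁ λ z wz → subst (λ q → q ∈ V₁) (sym (unique z wz)) p∈V₁
    ...     | inj₂ p∉V₁ = inj₂ (p , wp , p∉V₁)

    partner-outside : ∀ {w p x} → M w p ≡ true → p ∉ V₁ → M w x ≡ true → x ∉ V₁
    partner-outside wp p∉V₁ wx = subst (λ q → q ∉ V₁) (partner-unique P wp wx) p∉V₁

    Goal : Set
    Goal = PerfectMatching (deleteSet (side₁ S) D)

    both-inside : MatchedInside u → MatchedInside v → Goal
    both-inside u-in v-in =
      PerfectMatching-intro (side₁ S) D (PerfectOn-restrict T P closed T⊆alive)
        (λ _ x∈T → x∈T) (λ x → proj₂ ∘ ∈∖-elim V₁ D) edges
      where
      T : Subset n
      T = V₁ ∖ D
      stays-in-V₁ : ∀ x y → M x y ≡ true → x ∈ V₁ → y ∈ V₁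
      stays-in-V₁ x y xy x∈V₁ with toSum (x ≟ u) | toSum (x ≟ v)
      ... | inj₁ refl | _ = u-in y xy
      ... | inj₂ _ | inj₁ refl = v-in y xy
      ... | inj₂ x≢u | inj₂ x≢v = E-inside₁ x y (M⊆E x y xy) (∉V₂ S x∈V₁ x≢u x≢v)
      closed : ∀ x y → M x y ≡ true → x ∈ T → y ∈ T
      closed x y xy x∈T =
        ∈∖-intro V₁ D (stays-in-V₁ x y xy (proj₁ (∈∖-elim V₁ D x∈T))) (proj₂ (alive (matched-sym P xy)))
      T⊆alive : T ⊆ V H ∖ D
      T⊆alive x x∈T =
        let (x∈V₁ , x∉D) = ∈∖-elim V₁ D x∈T in ∈∖-intro (V H) D (V₁⊆V S x x∈V₁) x∉D
      edges : (M ⇂ T) ⊆₂ E (side₁ S)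
      edges x y e =
        let (xy , x∈T) = ∧-elim {M x y} e ; x∈V₁ = proj₁ (∈∖-elim V₁ D x∈T) in
        H-edge⇒side₁ S (M⊆E x y xy) x∈V₁ (stays-in-V₁ x y xy x∈V₁)

    both-outside : MatchedOutside u → MatchedOutside v → Goal
    both-outside (pu , u-pu , pu∉V₁) (pv , v-pv , pv∉V₁) =
      PerfectMatching-intro (side₁ S) D
        (PerfectOn-union (PerfectOn-restrict T P closed T⊆alive) (PerfectOn-pair u≢v) disjoint)
        covers avoids edges
      where
      T : Subset n
      T = inner₁ S ∖ D
      T-intro : ∀ {x} → x ∈ V₁ → x ∉ V₂ → x ∉ D → x ∈ T
      T-intro = inner₁∖-intro S D
      T-elim : ∀ {x} → x ∈ T → x ∈ V₁ × x ∉ V₂ × x ∉ D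
      T-elim = inner₁∖-elim S D
      closed : ∀ x y → M x y ≡ true → x ∈ T → y ∈ T
      closed x y xy x∈T =
        let (x∈V₁ , x∉V₂ , _) = T-elim x∈T
            y∈V₁ = E-inside₁ x y (M⊆E x y xy) x∉V₂
            y≢u : y ≢ u
            y≢u = λ { refl → true≢false x∈V₁ (partner-outside u-pu pu∉V₁ (matched-sym P xy)) }
            y≢v : y ≢ v
            y≢v = λ { refl → true≢false x∈V₁ (partner-outside v-pv pv∉V₁ (matched-sym P xy)) }
        in T-intro y∈V₁ (∉V₂ S y∈V₁ y≢u y≢v) (proj₂ (alive (matched-sym P xy)))
      T⊆alive : T ⊆ V H ∖ D
      T⊆alive x x∈T =
        let (x∈V₁ , _ , x∉D) = T-elim x∈T in ∈∖-intro (V H) D (V₁⊆V S x x∈V₁) x∉D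
      disjoint : ∀ x → x ∈ T → x ∈ pairSet u v → ⊥
      disjoint x x∈T x∈uv with ∈pair-elim u v x x∈uv
      ... | inj₁ refl = true≢false u∈V₂ (proj₁ (proj₂ (T-elim x∈T)))
      ... | inj₂ refl = true≢false v∈V₂ (proj₁ (proj₂ (T-elim x∈T)))
      covers : V₁ ∖ D ⊆ T ∪ pairSet u v
      covers x x∈ with ∈∖-elim V₁ D x∈ | toSum (x ≟ u) | toSum (x ≟ v)
      ... | _ | inj₁ refl | _ = ∨-introʳ (T u) (∈pairˡ u v)
      ... | _ | inj₂ _ | inj₁ refl = ∨-introʳ (T v) (∈pairʳ u v)
      ... | x∈V₁ , x∉D | inj₂ x≢u | inj₂ x≢v =
        ∨-introˡ (pairSet u v x) (T-intro x∈V₁ (∉V₂ S x∈V₁ x≢u x≢v) x∉D)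
      avoids : ∀ x → x ∈ T ∪ pairSet u v → x ∉ D
      avoids x x∈ with ∨-elim {T x} x∈
      ... | inj₁ x∈T = proj₂ (proj₂ (T-elim x∈T))
      ... | inj₂ x∈uv with ∈pair-elim u v x x∈uv
      ...   | inj₁ refl = proj₂ (alive u-pu)
      ...   | inj₂ refl = proj₂ (alive v-pv)
      edges : (M ⇂ T ∪₂ isPair u v) ⊆₂ E (side₁ S)
      edges x y e with ∨-elim {(M ⇂ T) x y} e
      ... | inj₂ uv = ∨-introʳ (E H x y ∧ V₁ x ∧ V₁ y) uv
      ... | inj₁ e′ =
        let (xy , x∈T) = ∧-elim {M x y} e′ in
        H-edge⇒side₁ S (M⊆E x y xy) (proj₁ (T-elim x∈T)) (proj₁ (T-elim (closed x y xy x∈T)))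

    -- B ∪ {w} would be closed under M, but has odd size because B = V₂ ∖ V₁ is even.
    not-split : ∀ {w w′} → Pair u v w w′ → MatchedOutside w → MatchedInside w′ → ⊥
    not-split {w} {w′} ww′ (p , wp , p∉V₁) w′-in =
      true≢false T-odd (PerfectOn⇒even (PerfectOn-restrict T P closed T⊆alive) (M-irrefl T) refl)
      where
      B : Subset n
      B = inner₁ (swap S)
      T : Subset n
      T = B ∪ ⁅ w ⁆
      w∈V₁ : w ∈ V₁
      w∈V₁ = Pair-∈V₁ S ww′
      p∈B : p ∈ B
      p∈B = ∈∖-intro V₂ V₁ (∈V₂-of-∉V₁ S (proj₁ (alive (matched-sym P wp))) p∉V₁) p∉V₁
      closed : ∀ x y → M x y ≡ true → x ∈ T → y ∈ T
      closed x y xy x∈T with ∨-elim {B x} x∈T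
      ... | inj₂ x≡w with ==-true x≡w
      ...   | refl = ∨-introˡ (y == w) (subst (λ q → q ∈ B) (sym (partner-unique P xy wp)) p∈B)
      closed x y xy x∈T | inj₁ x∈B with ∈∖-elim V₂ V₁ x∈B
      ...   | _ , x∉V₁ with true-or-false (V₁ y)
      ...     | inj₂ y∉V₁ = ∨-introˡ (y == w) (∈∖-intro V₂ V₁ (E-inside₂ x y (M⊆E x y xy) x∉V₁) y∉V₁)
      ...     | inj₁ y∈V₁ with V-meet-Pair S ww′ y y∈V₁ (E-inside₂ x y (M⊆E x y xy) x∉V₁)
      ...       | inj₁ refl = ∨-introʳ (B y) (==-refl y)
      ...       | inj₂ refl = ⊥-elim (true≢false (w′-in x (matched-sym P xy)) x∉V₁)
      T⊆alive : T ⊆ V H ∖ D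
      T⊆alive x x∈T with ∨-elim {B x} x∈T
      ... | inj₂ x≡w with ==-true x≡w
      ...   | refl = support P wp
      T⊆alive x x∈T | inj₁ x∈B =
        let (x∈V₂ , x∉V₁) = ∈∖-elim V₂ V₁ x∈B in ∈∖-intro (V H) D (V₁⊆V (swap S) x x∈V₂) (∉V₁⇒∉D x∉V₁)
      T∖w≗B : ∀ x → (T ∖ ⁅ w ⁆) x ≡ B x
      T∖w≗B x = ≡true-ext to from
        where
        to : x ∈ T ∖ ⁅ w ⁆ → x ∈ B
        to x∈ = let (x∈T , x≢w) = ∈∖-elim T ⁅ w ⁆ x∈ in
          [ id , (λ x≡w → ⊥-elim (true≢false x≡w x≢w)) ]′ (∨-elim {B x} x∈T)
        from : x ∈ B → x ∈ T ∖ ⁅ w ⁆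
        from x∈B = ∈∖-intro T ⁅ w ⁆ (∨-introˡ (x == w) x∈B)
          (==-false λ { refl → true≢false w∈V₁ (proj₂ (∈∖-elim V₂ V₁ x∈B)) })
      T-odd : isOdd (count T) ≡ true
      T-odd = begin
        isOdd (count T)                ≡⟨ cong isOdd (count-remove T (∨-introʳ (B w) (==-refl w))) ⟩
        not (isOdd (count (T ∖ ⁅ w ⁆))) ≡⟨ cong (not ∘ isOdd) (count-cong T∖w≗B) ⟩
        not (isOdd (count B))          ≡⟨ cong not (inner₁-even (swap S) H-minus-uv) ⟩
        true                           ∎
        where open ≡-Reasoning

    side-matching : Goal
    side-matching with inside-or-outside u u∈V₁ | inside-or-outside v v∈V₁
    ... | inj₁ u-in | inj₁ v-in = both-inside u-in v-in
    ... | inj₂ u-out | inj₂ v-out = both-outside u-out v-out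
    ... | inj₂ u-out | inj₁ v-in = ⊥-elim (not-split forward u-out v-in)
    ... | inj₁ u-in | inj₂ v-out = ⊥-elim (not-split backward v-out u-in)

  side₁-bicritical : (∃ λ a → a ∈ inner₁ S) → Bicritical (side₁ S)
  side₁-bicritical a∈inner =
    side₁-four a∈inner , λ a b a∈V₁ b∈V₁ a≢b → SideMatching.side-matching a∈V₁ b∈V₁ a≢b

-- Gluing bicritical sides

module _ {n} (S : Separation n) (bic₁ : Bicritical (side₁ S)) where
  open Separation S

  -- Match u to its partner w in side₁ - v - z, then add uw to a perfect matching of side₁ - u - w.
  side₁-perfect-in-H : ∀ {z} → z ∈ inner₁ S → ∃ λ N → PerfectOn V₁ N × N ⊆₂ E H
  side₁-perfect-in-H {z} z∈inner =
    Q ∪₂ isPair u w , PerfectOn-add-pair u∈V₁ w∈V₁ u≢w Q-perfect , N⊆E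
    where
    K = side₁ S
    z∈V₁ = proj₁ (inner₁-elim S z∈inner)
    z∉V₂ = proj₂ (inner₁-elim S z∈inner)
    K-minus-vz = PerfectMatching-elim K (pairSet v z) (side₁-edge-V₁ S)
                                      (proj₂ bic₁ v z v∈V₁ z∈V₁ (∉V₂⇒≢v S z∉V₂ ∘ sym))
    P = proj₁ (proj₂ K-minus-vz)
    u-alive : u ∈ V₁ ∖ pairSet v z
    u-alive = ∈∖pair-intro V₁ v z u∈V₁ u≢v (∉V₂⇒≢u S z∉V₂ ∘ sym)
    w : Fin n
    w = proj₁ (partner P u u-alive)
    uw∈M : proj₁ K-minus-vz u w ≡ true
    uw∈M = proj₁ (proj₂ (partner P u u-alive))
    uw∈K : E K u w ≡ true
    uw∈K = proj₂ (proj₂ K-minus-vz) u w uw∈M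
    w∈V₁ = proj₁ (∈∖pair-elim V₁ v z (supportʳ P uw∈M))
    w≢v = proj₁ (proj₂ (∈∖pair-elim V₁ v z (supportʳ P uw∈M)))
    u≢w : u ≢ w
    u≢w u≡w = true≢false (subst (λ q → E K u q ≡ true) (sym u≡w) uw∈K) (side₁-irrefl S u)
    uw∈H : E H u w ≡ true
    uw∈H = side₁-edge-H S u w uw∈K ([ u≢w ∘ sym , w≢v ]′ ∘ Pair-endpointʳ)
    K-minus-uw = PerfectMatching-elim K (pairSet u w) (side₁-edge-V₁ S) (proj₂ bic₁ u w u∈V₁ w∈V₁ u≢w)
    Q = proj₁ K-minus-uw
    Q-perfect = proj₁ (proj₂ K-minus-uw)
    N⊆E : (Q ∪₂ isPair u w) ⊆₂ E H
    N⊆E p q e with ∨-elim {Q p q} e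
    ... | inj₁ pq =
      let (_ , p≢u , _) = ∈∖pair-elim V₁ u w (support Q-perfect pq)
          (_ , q≢u , _) = ∈∖pair-elim V₁ u w (supportʳ Q-perfect pq)
      in side₁-edge-H S p q (proj₂ (proj₂ K-minus-uw) p q pq) ([ p≢u , q≢u ]′ ∘ Pair-touchesˡ)
    ... | inj₂ uw with isPair-elim u w p q uw
    ...   | forward = uw∈H
    ...   | backward = trans (E-sym w u) uw∈H

module _ {n} (S : Separation n) (bic₁ : Bicritical (side₁ S)) (bic₂ : Bicritical (side₁ (swap S)))
  where
  open Separation S

  module _ {x y} (x∈V₁ : x ∈ V₁) (y∈V₁ : y ∈ V₁) (x≢y : x ≢ y) where
    private
      D : Subset n
      D = pairSet x y
      side₁-minus-xy = PerfectMatching-elim (side₁ S) D (side₁-edge-V₁ S) (proj₂ bic₁ x y x∈V₁ y∈V₁ x≢y)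
      M₁ : Rel n
      M₁ = proj₁ side₁-minus-xy
      P₁ : PerfectOn (V₁ ∖ D) M₁
      P₁ = proj₁ (proj₂ side₁-minus-xy)
      M₁⊆E : M₁ ⊆₂ E (side₁ S)
      M₁⊆E = proj₂ (proj₂ side₁-minus-xy)
      ∉V₁⇒∉D : ∀ {p} → p ∉ V₁ → p ∉ D
      ∉V₁⇒∉D = ∉pair-of-∉ V₁ x∈V₁ y∈V₁

    both-in-V₁-avoiding-uv : M₁ u v ≡ false → PerfectMatching (deleteSet H D)
    both-in-V₁-avoiding-uv uv∉M₁ =
      PerfectMatching-intro H D (PerfectOn-union P₁ P₂ disjoint) covers avoids edges
      where
      side₂-minus-uv = PerfectMatching-elim (side₁ (swap S)) (pairSet u v) (side₁-edge-V₁ (swap S))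
                                            (proj₂ bic₂ u v u∈V₂ v∈V₂ u≢v)
      M₂ = proj₁ side₂-minus-uv
      P₂ : PerfectOn (V₂ ∖ pairSet u v) M₂
      P₂ = proj₁ (proj₂ side₂-minus-uv)
      disjoint : ∀ p → p ∈ V₁ ∖ D → p ∈ V₂ ∖ pairSet u v → ⊥
      disjoint p p∈₁ p∈₂ =
        let (p∈V₂ , p≢u , p≢v) = ∈∖pair-elim V₂ u v p∈₂ in
        [ p≢u , p≢v ]′ (V-meet p (proj₁ (∈∖-elim V₁ D p∈₁)) p∈V₂)
      covers : V H ∖ D ⊆ (V₁ ∖ D) ∪ (V₂ ∖ pairSet u v)
      covers p p∈ with ∈∖-elim (V H) D p∈
      ... | p∈V , p∉D with ∈V-elim S p∈V | toSum (p ≟ u) | toSum (p ≟ v)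
      ...   | inj₁ p∈V₁ | _ | _ = ∨-introˡ _ (∈∖-intro V₁ D p∈V₁ p∉D)
      ...   | inj₂ _ | inj₁ refl | _ = ∨-introˡ _ (∈∖-intro V₁ D u∈V₁ p∉D)
      ...   | inj₂ _ | inj₂ _ | inj₁ refl = ∨-introˡ _ (∈∖-intro V₁ D v∈V₁ p∉D)
      ...   | inj₂ p∈V₂ | inj₂ p≢u | inj₂ p≢v = ∨-introʳ _ (∈∖pair-intro V₂ u v p∈V₂ p≢u p≢v)
      avoids : ∀ p → p ∈ (V₁ ∖ D) ∪ (V₂ ∖ pairSet u v) → p ∉ D
      avoids p p∈ with ∨-elim {(V₁ ∖ D) p} p∈
      ... | inj₁ p∈₁ = proj₂ (∈∖-elim V₁ D p∈₁)
      ... | inj₂ p∈₂ =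
        let (p∈V₂ , p≢u , p≢v) = ∈∖pair-elim V₂ u v p∈₂ in ∉V₁⇒∉D (∉V₂ (swap S) p∈V₂ p≢u p≢v)
      edges : (M₁ ∪₂ M₂) ⊆₂ E H
      edges p q e with ∨-elim {M₁ p q} e
      ... | inj₁ pq = side₁-edge-H S p q (M₁⊆E p q pq) not-uv
        where
        not-uv : ¬ Pair u v p q
        not-uv forward = true≢false pq uv∉M₁
        not-uv backward = true≢false (matched-sym P₁ pq) uv∉M₁
      ... | inj₂ pq =
        let (_ , p≢u , p≢v) = ∈∖pair-elim V₂ u v (support P₂ pq) in
        side₁-edge-H (swap S) p q (proj₂ (proj₂ side₂-minus-uv) p q pq) ([ p≢u , p≢v ]′ ∘ Pair-endpointˡ)

    both-in-V₁-using-uv : (∃ λ b → b ∈ inner₁ (swap S)) → M₁ u v ≡ true → PerfectMatching (deleteSet H D)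
    both-in-V₁-using-uv (b , b∈inner₂) uv∈M₁ =
      PerfectMatching-intro H D
        (PerfectOn-union (PerfectOn-restrict T P₁ closed T⊆V₁∖D) (proj₁ (proj₂ V₂-in-H)) disjoint)
        covers avoids edges
      where
      V₂-in-H = side₁-perfect-in-H (swap S) bic₂ b∈inner₂
      N = proj₁ V₂-in-H
      T : Subset n
      T = inner₁ S ∖ D
      T-elim : ∀ {p} → p ∈ T → p ∈ V₁ × p ∉ V₂ × p ∉ D
      T-elim = inner₁∖-elim S D
      H-edge : ∀ {p q} → M₁ p q ≡ true → p ∉ V₂ → E H p q ≡ true
      H-edge {p} {q} pq p∉V₂ =
        side₁-edge-H S p q (M₁⊆E p q pq) ([ ∉V₂⇒≢u S p∉V₂ , ∉V₂⇒≢v S p∉V₂ ]′ ∘ Pair-endpointˡ)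
      closed : ∀ p q → M₁ p q ≡ true → p ∈ T → q ∈ T
      closed p q pq p∈T =
        let (p∈V₁ , p∉V₂ , _) = T-elim p∈T
            q∈V₁ = E-inside₁ p q (H-edge pq p∉V₂) p∉V₂
            q≢u : q ≢ u
            q≢u = λ { refl → ∉V₂⇒≢v S p∉V₂ (partner-unique P₁ (matched-sym P₁ pq) uv∈M₁) }
            q≢v : q ≢ v
            q≢v = λ { refl → ∉V₂⇒≢u S p∉V₂ (partner-unique P₁ (matched-sym P₁ pq) (matched-sym P₁ uv∈M₁)) }
        in inner₁∖-intro S D q∈V₁ (∉V₂ S q∈V₁ q≢u q≢v) (proj₂ (∈∖-elim V₁ D (supportʳ P₁ pq)))
      T⊆V₁∖D : T ⊆ V₁ ∖ D
      T⊆V₁∖D p p∈T = let (p∈V₁ , _ , p∉D) = T-elim p∈T in ∈∖-intro V₁ D p∈V₁ p∉D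
      disjoint : ∀ p → p ∈ T → p ∈ V₂ → ⊥
      disjoint p p∈T p∈V₂ = true≢false p∈V₂ (proj₁ (proj₂ (T-elim p∈T)))
      covers : V H ∖ D ⊆ T ∪ V₂
      covers p p∈ with ∈∖-elim (V H) D p∈ | true-or-false (V₂ p)
      ... | _ | inj₁ p∈V₂ = ∨-introʳ (T p) p∈V₂
      ... | p∈V , p∉D | inj₂ p∉V₂ =
        ∨-introˡ (V₂ p) (inner₁∖-intro S D (∈V₂-of-∉V₁ (swap S) p∈V p∉V₂) p∉V₂ p∉D)
      avoids : ∀ p → p ∈ T ∪ V₂ → p ∉ D
      avoids p p∈ with ∨-elim {T p} p∈
      ... | inj₁ p∈T = proj₂ (proj₂ (T-elim p∈T))
      ... | inj₂ p∈V₂ with toSum (p ≟ u) | toSum (p ≟ v)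
      ...   | inj₁ refl | _ = proj₂ (∈∖-elim V₁ D (support P₁ uv∈M₁))
      ...   | inj₂ _ | inj₁ refl = proj₂ (∈∖-elim V₁ D (supportʳ P₁ uv∈M₁))
      ...   | inj₂ p≢u | inj₂ p≢v = ∉V₁⇒∉D (∉V₂ (swap S) p∈V₂ p≢u p≢v)
      edges : (M₁ ⇂ T ∪₂ N) ⊆₂ E H
      edges p q e with ∨-elim {(M₁ ⇂ T) p q} e
      ... | inj₁ e′ = let (pq , p∈T) = ∧-elim {M₁ p q} e′ in H-edge pq (proj₁ (proj₂ (T-elim p∈T)))
      ... | inj₂ pq = proj₂ (proj₂ V₂-in-H) p q pq

    -- If side₁ - x - y is matched using the edge uv, the rest of V₁ is matched inside H and V₂
    -- is matched by side₁-perfect-in-H; otherwise add a matching of side₂ - u - v.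
    both-in-V₁ : (∃ λ b → b ∈ inner₁ (swap S)) → PerfectMatching (deleteSet H (pairSet x y))
    both-in-V₁ b∈inner₂ =
      [ both-in-V₁-using-uv b∈inner₂ , both-in-V₁-avoiding-uv ]′ (true-or-false (M₁ u v))

  -- Combine matchings of side₁ - x - v and side₂ - y - u.
  across : ∀ {x y} → x ∈ inner₁ S → y ∈ inner₁ (swap S) → PerfectMatching (deleteSet H (pairSet x y))
  across {x} {y} x∈inner₁ y∈inner₂ =
    PerfectMatching-intro H (pairSet x y) (PerfectOn-union P₁ P₂ disjoint) covers avoids edges
    where
    x∈V₁ = proj₁ (inner₁-elim S x∈inner₁)
    x∉V₂ = proj₂ (inner₁-elim S x∈inner₁)
    y∈V₂ = proj₁ (inner₁-elim (swap S) y∈inner₂)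
    y∉V₁ = proj₂ (inner₁-elim (swap S) y∈inner₂)
    side₁-minus-xv = PerfectMatching-elim (side₁ S) (pairSet x v) (side₁-edge-V₁ S)
                                          (proj₂ bic₁ x v x∈V₁ v∈V₁ (∉V₂⇒≢v S x∉V₂))
    side₂-minus-yu = PerfectMatching-elim (side₁ (swap S)) (pairSet y u) (side₁-edge-V₁ (swap S))
                                          (proj₂ bic₂ y u y∈V₂ u∈V₂ (∉V₂⇒≢u (swap S) y∉V₁))
    M₁ = proj₁ side₁-minus-xv
    M₂ = proj₁ side₂-minus-yu
    P₁ : PerfectOn (V₁ ∖ pairSet x v) M₁
    P₁ = proj₁ (proj₂ side₁-minus-xv)
    P₂ : PerfectOn (V₂ ∖ pairSet y u) M₂
    P₂ = proj₁ (proj₂ side₂-minus-yu)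
    disjoint : ∀ p → p ∈ V₁ ∖ pairSet x v → p ∈ V₂ ∖ pairSet y u → ⊥
    disjoint p p∈₁ p∈₂ =
      let (p∈V₁ , _ , p≢v) = ∈∖pair-elim V₁ x v p∈₁ ; (p∈V₂ , _ , p≢u) = ∈∖pair-elim V₂ y u p∈₂ in
      [ p≢u , p≢v ]′ (V-meet p p∈V₁ p∈V₂)
    covers : V H ∖ pairSet x y ⊆ (V₁ ∖ pairSet x v) ∪ (V₂ ∖ pairSet y u)
    covers p p∈ with ∈∖pair-elim (V H) x y p∈ | toSum (p ≟ u) | toSum (p ≟ v)
    ... | _ | inj₁ refl | _ =
      ∨-introˡ _ (∈∖pair-intro V₁ x v u∈V₁ (∉V₂⇒≢u S x∉V₂ ∘ sym) u≢v)
    ... | _ | inj₂ _ | inj₁ refl =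
      ∨-introʳ _ (∈∖pair-intro V₂ y u v∈V₂ (∉V₂⇒≢v (swap S) y∉V₁ ∘ sym) (u≢v ∘ sym))
    ... | p∈V , p≢x , p≢y | inj₂ p≢u | inj₂ p≢v =
      [ (λ p∈V₁ → ∨-introˡ _ (∈∖pair-intro V₁ x v p∈V₁ p≢x p≢v)) ,
        (λ p∈V₂ → ∨-introʳ _ (∈∖pair-intro V₂ y u p∈V₂ p≢y p≢u)) ]′ (∈V-elim S p∈V)
    avoids : ∀ p → p ∈ (V₁ ∖ pairSet x v) ∪ (V₂ ∖ pairSet y u) → p ∉ pairSet x y
    avoids p p∈ with ∨-elim {(V₁ ∖ pairSet x v) p} p∈
    ... | inj₁ p∈₁ =
      let (p∈V₁ , p≢x , _) = ∈∖pair-elim V₁ x v p∈₁ in ∉pair x y p p≢x (λ { refl → true≢false p∈V₁ y∉V₁ })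
    ... | inj₂ p∈₂ =
      let (p∈V₂ , p≢y , _) = ∈∖pair-elim V₂ y u p∈₂ in ∉pair x y p (λ { refl → true≢false p∈V₂ x∉V₂ }) p≢y
    edges : (M₁ ∪₂ M₂) ⊆₂ E H
    edges p q e with ∨-elim {M₁ p q} e
    ... | inj₁ pq =
      let (_ , _ , p≢v) = ∈∖pair-elim V₁ x v (support P₁ pq)
          (_ , _ , q≢v) = ∈∖pair-elim V₁ x v (supportʳ P₁ pq) in
      side₁-edge-H S p q (proj₂ (proj₂ side₁-minus-xv) p q pq) ([ p≢v , q≢v ]′ ∘ Pair-touchesˡ ∘ Pair-comm)
    ... | inj₂ pq =
      let (_ , _ , p≢u) = ∈∖pair-elim V₂ y u (support P₂ pq)
          (_ , _ , q≢u) = ∈∖pair-elim V₂ y u (supportʳ P₂ pq) in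
      side₁-edge-H (swap S) p q (proj₂ (proj₂ side₂-minus-yu) p q pq) ([ p≢u , q≢u ]′ ∘ Pair-touchesˡ)

module _ {n} (S : Separation n) where
  open Separation S

  Bicritical-glue : 4 ≤ count (V H) → Bicritical (side₁ S) → Bicritical (side₁ (swap S)) →
    (∃ λ a → a ∈ inner₁ S) → (∃ λ b → b ∈ inner₁ (swap S)) → Bicritical H
  Bicritical-glue four bic₁ bic₂ a∈inner₁ b∈inner₂ = four , matchable
    where
    inner₂-intro : ∀ {x} → x ∈ V H → x ∉ V₁ → x ∈ inner₁ (swap S)
    inner₂-intro x∈V x∉V₁ = ∈∖-intro V₂ V₁ (∈V₂-of-∉V₁ S x∈V x∉V₁) x∉V₁
    matchable : ∀ x y → x ∈ V H → y ∈ V H → x ≢ y → PerfectMatching (deleteSet H (pairSet x y))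
    matchable x y x∈V y∈V x≢y with true-or-false (V₁ x) | true-or-false (V₁ y)
    ... | inj₁ x∈V₁ | inj₁ y∈V₁ = both-in-V₁ S bic₁ bic₂ x∈V₁ y∈V₁ x≢y b∈inner₂
    ... | inj₂ x∉V₁ | inj₂ y∉V₁ =
      both-in-V₁ (swap S) bic₂ bic₁ (∈V₂-of-∉V₁ S x∈V x∉V₁) (∈V₂-of-∉V₁ S y∈V y∉V₁) x≢y a∈inner₁
    ... | inj₁ x∈V₁ | inj₂ y∉V₁ with true-or-false (V₂ x)
    ...   | inj₁ x∈V₂ = both-in-V₁ (swap S) bic₂ bic₁ x∈V₂ (∈V₂-of-∉V₁ S y∈V y∉V₁) x≢y a∈inner₁
    ...   | inj₂ x∉V₂ = across S bic₁ bic₂ (∈∖-intro V₁ V₂ x∈V₁ x∉V₂) (inner₂-intro y∈V y∉V₁)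
    matchable x y x∈V y∈V x≢y | inj₂ x∉V₁ | inj₁ y∈V₁ with true-or-false (V₂ y)
    ...   | inj₁ y∈V₂ = both-in-V₁ (swap S) bic₂ bic₁ (∈V₂-of-∉V₁ S x∈V x∉V₁) y∈V₂ x≢y a∈inner₁
    ...   | inj₂ y∉V₂ = across (swap S) bic₂ bic₁ (inner₂-intro x∈V x∉V₁) (∈∖-intro V₁ V₂ y∈V₁ y∉V₂)

-- The decomposition G = G₁′ ∪ G₂′ of the theorem

module Decomposition {n} (G G₁′ G₂′ : Graph n) (u v : Fin n)
  (isGraph₁ : IsGraph G₁′) (isGraph₂ : IsGraph G₂′)
  (V-union : ∀ x → V G x ≡ V G₁′ x ∨ V G₂′ x)
  (E-union : ∀ x y → E G x y ≡ E G₁′ x y ∨ E G₂′ x y)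
  (V-meet : ∀ x → (V G₁′ x ∧ V G₂′ x ≡ true) ⇔ (x ≡ u ⊎ x ≡ v))
  (u≢v : u ≢ v) where

  in-both : ∀ {x} → x ≡ u ⊎ x ≡ v → x ∈ V G₁′ × x ∈ V G₂′
  in-both {x} x∈uv = ∧-elim {V G₁′ x} (Equivalence.from (V-meet x) x∈uv)

  E-elim : ∀ {x y} → E G x y ≡ true → E G₁′ x y ≡ true ⊎ E G₂′ x y ≡ true
  E-elim {x} {y} e = ∨-elim {E G₁′ x y} (trans (sym (E-union x y)) e)

  E₁⊆E : ∀ {x y} → E G₁′ x y ≡ true → E G x y ≡ true
  E₁⊆E {x} {y} e = trans (E-union x y) (∨-introˡ (E G₂′ x y) e)

  G-sym : ∀ x y → E G x y ≡ E G y x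
  G-sym x y =
    trans (E-union x y) (trans (cong₂ _∨_ (proj₁ isGraph₁ x y) (proj₁ isGraph₂ x y)) (sym (E-union y x)))

  G-irrefl : Irreflexive (E G)
  G-irrefl x = ¬-not λ xx → [ IsGraph-≢ isGraph₁ , IsGraph-≢ isGraph₂ ]′ (E-elim xx) refl

  edge-side : ∀ {x y} → E G x y ≡ true → (x ∈ V G₁′ × y ∈ V G₁′) ⊎ (x ∈ V G₂′ × y ∈ V G₂′)
  edge-side e = Data.Sum.map (IsGraph-edge isGraph₁) (IsGraph-edge isGraph₂) (E-elim e)

  separation : (H : Graph n) → (∀ x → V H x ≡ V G x) → E H ⊆₂ E G → (∀ x y → E H x y ≡ E H y x) →
    Separation n
  separation H V≗ E⊆ H-sym = record
    { H = H ; V₁ = V G₁′ ; V₂ = V G₂′ ; u = u ; v = v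
    ; V-split = λ x → trans (V≗ x) (V-union x)
    ; V-meet = λ x x∈₁ x∈₂ → Equivalence.to (V-meet x) (∧-intro x∈₁ x∈₂)
    ; u∈V₁ = proj₁ (in-both (inj₁ refl)) ; u∈V₂ = proj₂ (in-both (inj₁ refl))
    ; v∈V₁ = proj₁ (in-both (inj₂ refl)) ; v∈V₂ = proj₂ (in-both (inj₂ refl))
    ; u≢v = u≢v
    ; E-inside₁ = λ x y e x∉₂ →
        [ proj₂ , (λ (x∈₂ , _) → ⊥-elim (true≢false x∈₂ x∉₂)) ]′ (edge-side (E⊆ x y e))
    ; E-inside₂ = λ x y e x∉₁ →
        [ (λ (x∈₁ , _) → ⊥-elim (true≢false x∈₁ x∉₁)) , proj₂ ]′ (edge-side (E⊆ x y e))
    ; E-sym = H-sym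
    ; E-irrefl = ⊆₂-irreflexive E⊆ G-irrefl
    ; E-vertex = λ x y e → trans (V≗ x) (trans (V-union x)
        ([ ∨-introˡ (V G₂′ x) ∘ proj₁ , ∨-introʳ (V G₁′ x) ∘ proj₁ ]′ (edge-side (E⊆ x y e))))
    }

  G-sep : Separation n
  G-sep = separation G (λ _ → refl) (λ _ _ e → e) G-sym

  minus : Fin n → Fin n → Separation n
  minus x y = separation (removeEdge G x y) (λ _ → refl) (λ p q → proj₁ ∘ ∧-elim {E G p q})
    (λ p q → cong₂ _∧_ (G-sym p q) (cong not (isPair-sym x y p q)))

  interior-nonempty : Connected G₁′ → ¬ IsK2 G₁′ → ∃ λ a → a ∈ inner₁ G-sep
  interior-nonempty conn ¬K₂ with ∃∈-or-empty (inner₁ G-sep)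
  ... | inj₁ a∈inner = a∈inner
  ... | inj₂ empty = ⊥-elim (¬K₂ (count₁≡2 , proj₁ uv-edge , v , proj₂ uv-edge))
    where
    uv-edge = Connected⇒edge conn (proj₁ (in-both (inj₁ refl))) (proj₁ (in-both (inj₂ refl))) u≢v
    count₁≡2 : count (V G₁′) ≡ 2
    count₁≡2 = trans (count-V₁ G-sep) (cong (λ k → suc (suc k)) (count-empty (inner₁ G-sep) empty))

  shared-edge : ∀ {K : Graph n} → IsGraph K → ∀ {p q} → E K p q ≡ true →
    p ∈ V G₁′ → p ∈ V G₂′ → q ∈ V G₁′ → q ∈ V G₂′ → Pair u v p q
  shared-edge isGraph e p∈₁ p∈₂ q∈₁ q∈₂ =
    Pair-of-endpoints (meet p∈₁ p∈₂) (meet q∈₁ q∈₂) (IsGraph-≢ isGraph e)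
    where
    meet : ∀ {x} → x ∈ V G₁′ → x ∈ V G₂′ → x ≡ u ⊎ x ≡ v
    meet {x} x∈₁ x∈₂ = Equivalence.to (V-meet x) (∧-intro x∈₁ x∈₂)

  G₁ : Graph n
  G₁ = addEdge G₁′ u v

  E-Pair : ∀ {x y} → Pair u v x y → E G x y ≡ E G u v
  E-Pair forward = refl
  E-Pair backward = G-sym v u

  G₁-edge-elim : ∀ {x y} → E G₁ x y ≡ true → ¬ Pair u v x y → E G₁′ x y ≡ true
  G₁-edge-elim {x} {y} e ¬uv =
    [ id , (λ uv → ⊥-elim (¬uv (isPair-elim u v x y uv))) ]′ (∨-elim {E G₁′ x y} e)

  G₁-minus⊆side₁ : ∀ x y → E (removeEdge G₁ x y) ⊆₂ E (side₁ (minus x y))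
  G₁-minus⊆side₁ x y p q e with ∧-elim {E G₁′ p q ∨ isPair u v p q} e
  ... | pq∈G₁ , pq∉xy with ∨-elim {E G₁′ p q} pq∈G₁
  ...   | inj₂ uv = ∨-introʳ (E (removeEdge G x y) p q ∧ V G₁′ p ∧ V G₁′ q) uv
  ...   | inj₁ e₁ =
    let (p∈₁ , q∈₁) = IsGraph-edge isGraph₁ e₁ in
    H-edge⇒side₁ (minus x y) (∧-intro (E₁⊆E e₁) pq∉xy) p∈₁ q∈₁

  side₁⊆G₁-minus : ∀ x y → ¬ Pair u v x y → E (side₁ (minus x y)) ⊆₂ E (removeEdge G₁ x y)
  side₁⊆G₁-minus x y ¬uv p q e with ∨-elim {E (removeEdge G x y) p q ∧ V G₁′ p ∧ V G₁′ q} e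
  ... | inj₂ uv = ∧-intro (∨-introʳ (E G₁′ p q) uv) (not-false (isPair-false (¬uv ∘ uv-via)))
    where
    uv-via : Pair x y p q → Pair u v x y
    uv-via xy = Pair-trans (isPair-elim u v p q uv) (Pair-flip xy)
  ... | inj₁ h with ∧-elim {E (removeEdge G x y) p q} h
  ...   | pq∈G-xy , p∈₁-q∈₁ with ∧-elim {E G p q} pq∈G-xy | ∧-elim {V G₁′ p} p∈₁-q∈₁
  ...     | pq∈G , pq∉xy | p∈₁ , q∈₁ = ∧-intro (E-in-G₁ (E-elim pq∈G)) pq∉xy
    where
    E-in-G₁ : E G₁′ p q ≡ true ⊎ E G₂′ p q ≡ true → (E G₁′ p q ∨ isPair u v p q) ≡ true
    E-in-G₁ (inj₁ e₁) = ∨-introˡ (isPair u v p q) e₁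
    E-in-G₁ (inj₂ e₂) =
      let (p∈₂ , q∈₂) = IsGraph-edge isGraph₂ e₂ in
      ∨-introʳ (E G₁′ p q) (isPair-intro (shared-edge isGraph₂ e₂ p∈₁ p∈₂ q∈₁ q∈₂))

  induced+-minus : ∀ (W : Subset n) x y → (∀ {p q} → Pair x y p q → p ∈ W → q ∈ W → Pair u v p q) →
    E (induced+ G W u v) ⊆₂ E (induced+ (removeEdge G x y) W u v)
  induced+-minus W x y xy⇒uv p q e with Pair-dec u v p q
  ... | inj₁ uv = ∨-introʳ (E (removeEdge G x y) p q ∧ W p ∧ W q) (isPair-intro uv)
  ... | inj₂ ¬uv with ∨-elim {E G p q ∧ W p ∧ W q} e
  ...   | inj₂ uv = ⊥-elim (¬uv (isPair-elim u v p q uv))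
  ...   | inj₁ h with ∧-elim {E G p q} h
  ...     | pq∈G , p∈W-q∈W with ∧-elim {W p} p∈W-q∈W
  ...       | p∈W , q∈W =
    ∨-introˡ (isPair u v p q)
      (∧-intro (∧-intro pq∈G (not-false (isPair-false λ xy → ¬uv (xy⇒uv xy p∈W q∈W)))) p∈W-q∈W)

  module _ (bic : Bicritical G)
    (a∈inner₁ : ∃ λ a → a ∈ inner₁ G-sep) (b∈inner₂ : ∃ λ b → b ∈ inner₁ (swap G-sep)) where

    side₂-bicritical : Bicritical (side₁ (swap G-sep))
    side₂-bicritical = side₁-bicritical (swap G-sep) bic b∈inner₂

    bicritical-minus : ∀ {x y} → Bicritical (side₁ (minus x y)) → Bicritical (side₁ (swap (minus x y))) →
      Bicritical (removeEdge G x y)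
    bicritical-minus {x} {y} bic₁ bic₂ =
      Bicritical-glue (minus x y) (proj₁ bic) bic₁ bic₂ a∈inner₁ b∈inner₂

    deletable-G⇒G₁ : ∀ {x y} → Deletable G x y → E G₁ x y ≡ true → ¬ Pair u v x y → Deletable G₁ x y
    deletable-G⇒G₁ {x} {y} (_ , bic-xy) xy∈G₁ ¬uv =
      xy∈G₁ ,
      Bicritical-mono (side₁ (minus x y)) (removeEdge G₁ x y) (λ _ → refl) (side₁⊆G₁-minus x y ¬uv)
        (side₁-bicritical (minus x y) bic-xy a∈inner₁)

    deletable-G₁⇒G : ∀ {x y} → Deletable G₁ x y → ¬ Pair u v x y → Deletable G x y × E G₁ x y ≡ true
    deletable-G₁⇒G {x} {y} (xy∈G₁ , bic-xy) ¬uv =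
      (E₁⊆E xy∈G₁′ ,
       bicritical-minus
         (Bicritical-mono (removeEdge G₁ x y) (side₁ (minus x y)) (λ _ → refl) (G₁-minus⊆side₁ x y) bic-xy)
         (Bicritical-mono (side₁ (swap G-sep)) (side₁ (swap (minus x y))) (λ _ → refl)
           (induced+-minus (V G₂′) x y xy⇒uv) side₂-bicritical)) ,
      xy∈G₁
      where
      xy∈G₁′ = G₁-edge-elim xy∈G₁ ¬uv
      xy⇒uv : ∀ {p q} → Pair x y p q → p ∈ V G₂′ → q ∈ V G₂′ → Pair u v p q
      xy⇒uv xy p∈₂ q∈₂ =
        let pq∈G₁′ = IsGraph-Pair isGraph₁ xy∈G₁′ xy ; (p∈₁ , q∈₁) = IsGraph-edge isGraph₁ pq∈G₁′ in
        shared-edge isGraph₁ pq∈G₁′ p∈₁ p∈₂ q∈₁ q∈₂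

    uv-deletable : E G u v ≡ true → ∀ {x y} → Pair u v x y → Deletable G x y × E G₁ x y ≡ true
    uv-deletable uv∈E {x} {y} uv =
      (trans (E-Pair uv) uv∈E ,
       bicritical-minus
         (Bicritical-mono (side₁ G-sep) (side₁ (minus x y)) (λ _ → refl)
           (induced+-minus (V G₁′) x y xy⇒uv) (side₁-bicritical G-sep bic a∈inner₁))
         (Bicritical-mono (side₁ (swap G-sep)) (side₁ (swap (minus x y))) (λ _ → refl)
           (induced+-minus (V G₂′) x y xy⇒uv) side₂-bicritical)) ,
      ∨-introʳ (E G₁′ x y) (isPair-intro uv)
      where
      xy⇒uv : ∀ {W : Subset n} {p q} → Pair x y p q → p ∈ W → q ∈ W → Pair u v p q
      xy⇒uv xy _ _ = Pair-trans uv xy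

    DE-side₁ : DEClaim G G₁′ u v
    DE-side₁ = uv∉G , uv∈G
      where
      uv∉G : E G u v ≡ false → ∀ x y →
        (Deletable G₁ x y × ¬ IsUV u v x y) ⇔ (Deletable G x y × E G₁ x y ≡ true)
      uv∉G uv∉E x y = mk⇔ (λ (del , ¬uv) → deletable-G₁⇒G del (¬uv ∘ isPair-intro)) from
        where
        from : Deletable G x y × E G₁ x y ≡ true → Deletable G₁ x y × ¬ IsUV u v x y
        from (del , xy∈G₁) = deletable-G⇒G₁ del xy∈G₁ ¬uv , ¬uv ∘ isPair-elim u v x y
          where
          ¬uv : ¬ Pair u v x y
          ¬uv uv = true≢false (trans (sym (E-Pair uv)) (proj₁ del)) uv∉E
      uv∈G : E G u v ≡ true → ∀ x y →
        (Deletable G₁ x y ⊎ IsUV u v x y) ⇔ (Deletable G x y × E G₁ x y ≡ true)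
      uv∈G uv∈E x y = mk⇔
        [ (λ del → [ uv-deletable uv∈E , deletable-G₁⇒G del ]′ (Pair-dec u v x y)) ,
          uv-deletable uv∈E ∘ isPair-elim u v x y ]′
        (λ (del , xy∈G₁) → [ inj₂ ∘ isPair-intro , inj₁ ∘ deletable-G⇒G₁ del xy∈G₁ ]′ (Pair-dec u v x y))

lemma3p2 : ∀ {n} (G G₁' G₂' : Graph n) (u v : Fin n)
    → IsGraph G₁' → IsGraph G₂'
    → (∀ x → V G x ≡ V G₁' x ∨ V G₂' x)
    → (∀ x y → E G x y ≡ E G₁' x y ∨ E G₂' x y)
    → (∀ x → (V G₁' x ∧ V G₂' x ≡ true) ⇔ (x ≡ u ⊎ x ≡ v))
    → Connected G₁' → Connected G₂'
    → ¬ IsK2 G₁' → ¬ IsK2 G₂'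
    → Bicritical G
    → TwoSeparation G u v
    → DEClaim G G₁' u v × DEClaim G G₂' u v
lemma3p2 G G₁′ G₂′ u v isGraph₁ isGraph₂ V-union E-union V-meet conn₁ conn₂ ¬K₂₁ ¬K₂₂ bic separation =
  D₁.DE-side₁ bic interior₁ interior₂ , D₂.DE-side₁ bic interior₂ interior₁
  where
  u≢v : u ≢ v
  u≢v = proj₁ (proj₂ (proj₂ (proj₁ separation)))
  module D₁ = Decomposition G G₁′ G₂′ u v isGraph₁ isGraph₂ V-union E-union V-meet u≢v
  module D₂ = Decomposition G G₂′ G₁′ u v isGraph₂ isGraph₁
    (λ x → trans (V-union x) (∨-comm (V G₁′ x) (V G₂′ x)))
    (λ x y → trans (E-union x y) (∨-comm (E G₁′ x y) (E G₂′ x y)))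
    (λ x → subst (λ b → (b ≡ true) ⇔ (x ≡ u ⊎ x ≡ v)) (∧-comm (V G₁′ x) (V G₂′ x)) (V-meet x))
    u≢v
  interior₁ = D₁.interior-nonempty conn₁ ¬K₂₁
  interior₂ = D₂.interior-nonempty conn₂ ¬K₂₂
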